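{- Let $\mathcal{A}$ be a $\mathbf{tDL}$-algebra and let $B(A)$ be the set of complemented (Boolean) elements of its underlying lattice, with $\neg x$ the complement of $x$. Then $B(A)$ is closed under $\mathbf{G}$ and $\mathbf{H}$, and $\langle B(A),\wedge,\vee,\neg,\mathbf{G},\mathbf{H},0,1\rangle$ is a tense algebra.
   Context: A $\mathbf{tDL}$-algebra is a bounded distributive lattice $\langle A,\wedge,\vee,0,1\rangle$ with unary operators $\mathbf{G},\mathbf{H},\mathbf{F},\mathbf{P}$ such that for all $x,y$: (t1) $\mathbf{G}1=\mathbf{H}1=1$; (t2) $\mathbf{G},\mathbf{H}$ preserve $\wedge$; (t3) $x\le\mathbf{G}\mathbf{P}x$, $x\le\mathbf{H}\mathbf{F}x$; (t4) $\mathbf{G}(x\vee y)\le\mathbf{G}x\vee\mathbf{F}y$, $\mathbf{H}(x\vee y)\le\mathbf{H}x\vee\mathbf{P}y$; (t5) $\mathbf{F}0=\mathbf{P}0=0$; (t6) $\mathbf{F},\mathbf{P}$ preserve $\vee$; (t7) $\mathbf{P}\mathbf{G}x\le x$, $\mathbf{F}\mathbf{H}x\le x$; (t8) $\mathbf{G}x\wedge\mathbf{F}y\le\mathbf{F}(x\wedge y)$, $\mathbf{H}x\wedge\mathbf{P}y\le\mathbf{P}(x\wedge y)$. A tense algebra is $\langle B,\wedge,\vee,\neg,\mathbf{G},\mathbf{H},0,1\rangle$ with $\langle B,\wedge,\vee,\neg,0,1\rangle$ a Boolean algebra and $\mathbf{G},\mathbf{H}$ unary operators satisfying (t1), (t2)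 and (t3), where in (t3) $\mathbf{F}$ and $\mathbf{P}$ denote the defined operators $\mathbf{F}x=\neg\mathbf{G}\neg x$, $\mathbf{P}x=\neg\mathbf{H}\neg x$. -}

module Defs where

open import Level using (Level; _⊔_; suc)
open import Data.Product using (Σ; ∃; _×_; _,_; proj₁; proj₂)
open import Relation.Binary.PropositionalEquality using (_≡_)
open import Relation.Binary.Core using (Rel)
open import Algebra.Core using (Op₁; Op₂)
open import Algebra.Lattice.Structures using (IsDistributiveLattice; IsBooleanAlgebra)

record TDL (a : Level) : Set (suc a) where
  infixr 7 _∧_
  infixr 6 _∨_
  field
    Carrier : Set a
    _∧_ _∨_ : Op₂ Carrier
    𝟘 𝟙     : Carrier
    G H F P : Op₁ Carrier
    isDistributiveLattice : IsDistributiveLattice _≡_ _∨_ _∧_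
    𝟘-bot : ∀ x → 𝟘 ∧ x ≡ 𝟘
    𝟙-top : ∀ x → x ∧ 𝟙 ≡ x
    -- axioms (x ≤ y written as x ∧ y ≡ x)

    t1G : G 𝟙 ≡ 𝟙
    t1H : H 𝟙 ≡ 𝟙
    t2G : ∀ x y → G (x ∧ y) ≡ G x ∧ G y
    t2H : ∀ x y → H (x ∧ y) ≡ H x ∧ H y
    t3G : ∀ x → x ∧ G (P x) ≡ x
    t3H : ∀ x → x ∧ H (F x) ≡ x
    t4G : ∀ x y → G (x ∨ y) ∧ (G x ∨ F y) ≡ G (x ∨ y)
    t4H : ∀ x y → H (x ∨ y) ∧ (H x ∨ P y) ≡ H (x ∨ y)
    t5F : F 𝟘 ≡ 𝟘
    t5P : P 𝟘 ≡ 𝟘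
    t6F : ∀ x y → F (x ∨ y) ≡ F x ∨ F y
    t6P : ∀ x y → P (x ∨ y) ≡ P x ∨ P y
    t7P : ∀ x → P (G x) ∧ x ≡ P (G x)
    t7F : ∀ x → F (H x) ∧ x ≡ F (H x)
    t8F : ∀ x y → (G x ∧ F y) ∧ F (x ∧ y) ≡ (G x ∧ F y)
    t8P : ∀ x y → (H x ∧ P y) ∧ P (x ∧ y) ≡ (H x ∧ P y)

record IsTenseAlgebra {b ℓ : Level} {B : Set b} (_≈_ : Rel B ℓ)
         (_∨_ _∧_ : Op₂ B) (¬ : Op₁ B) (⊤ ⊥ : B) (G H : Op₁ B) : Set (b ⊔ ℓ) where
  field
    isBooleanAlgebra : IsBooleanAlgebra _≈_ _∨_ _∧_ ¬ ⊤ ⊥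
    G-cong : ∀ {x y} → x ≈ y → G x ≈ G y
    H-cong : ∀ {x y} → x ≈ y → H x ≈ H y

    -- with F x = ¬ G ¬ x, P x = ¬ H ¬ x, and x ≤ y meaning x ∧ y ≈ x
    t1G : G ⊤ ≈ ⊤
    t1H : H ⊤ ≈ ⊤
    t2G : ∀ x y → G (x ∧ y) ≈ (G x ∧ G y)
    t2H : ∀ x y → H (x ∧ y) ≈ (H x ∧ H y)
    t3G : ∀ x → (x ∧ G (¬ (H (¬ x)))) ≈ x
    t3H : ∀ x → (x ∧ H (¬ (G (¬ x)))) ≈ x

module _ {a : Level} (A : TDL a) where
  open TDL A

  IsComplement : Carrier → Carrier → Set a
  IsComplement x y = (x ∧ y ≡ 𝟘) × (x ∨ y ≡ 𝟙)

  Complemented : Carrier → Set a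
  Complemented x = ∃ λ y → IsComplement x y

  BA : Set a
  BA = Σ Carrier Complemented

  _≈B_ : Rel BA a
  u ≈B v = proj₁ u ≡ proj₁ v

  -- the complement on B(A) (complements are unique in a distributive lattice)
  ¬B : Op₁ BA
  ¬B (x , y , (p , q)) = y , x , (∧-comm' p , ∨-comm' q)
    where
      open IsDistributiveLattice isDistributiveLattice using (∧-comm; ∨-comm)
      open import Relation.Binary.PropositionalEquality using (trans)
      ∧-comm' : x ∧ y ≡ 𝟘 → y ∧ x ≡ 𝟘
      ∧-comm' e = trans (∧-comm y x) e
      ∨-comm' : x ∨ y ≡ 𝟙 → y ∨ x ≡ 𝟙
      ∨-comm' e = trans (∨-comm y x) e

  record BClosure : Set a where
    field
      ∧-closed : ∀ {x y} → Complemented x → Complemented y → Complemented (x ∧ y)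
      ∨-closed : ∀ {x y} → Complemented x → Complemented y → Complemented (x ∨ y)
      𝟘-closed : Complemented 𝟘
      𝟙-closed : Complemented 𝟙
      G-closed : ∀ {x} → Complemented x → Complemented (G x)
      H-closed : ∀ {x} → Complemented x → Complemented (H x)

  module BOps (c : BClosure) where
    open BClosure c
    _∧B_ _∨B_ : Op₂ BA
    (x , p) ∧B (y , q) = x ∧ y , ∧-closed p q
    (x , p) ∨B (y , q) = x ∨ y , ∨-closed p q
    𝟘B 𝟙B : BA
    𝟘B = 𝟘 , 𝟘-closed
    𝟙B = 𝟙 , 𝟙-closed
    GB HB : Op₁ BA
    GB (x , p) = G x , G-closed p
    HB (x , p) = H x , H-closed p

  BIsTense : BClosure → Set a
  BIsTense c = IsTenseAlgebra _≈B_ _∨B_ _∧B_ ¬B 𝟙B 𝟘B GB HB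
    where open BOps c

{-# OPTIONS --safe #-}
-- G1 = 1 and G(x ∨ y) ≤ Gx ∨ Fy turn x ∨ x' = 1 into Gx ∨ Fx' = 1, while F0 = 0 and
-- Gx ∧ Fy ≤ F(x ∧ y) turn x ∧ x' = 0 into Gx ∧ Fx' = 0; so Fx' is the complement of Gx,
-- and likewise Px' that of Hx. Complemented elements of a bounded distributive lattice
-- form a Boolean algebra, and since the complement of H(¬x) is then P x on the nose,
-- the tense axioms (t3) of B(A) are literally those of A.
module Submission where

open import Defs
open import Level using (Level)
open import Function using (id)
open import Data.Product using (Σ; _,_; proj₁)
open import Relation.Binary.PropositionalEquality
open import Algebra.Core using (Op₁; Op₂)
open import Algebra.Lattice.Structures using (IsDistributiveLattice)
open import Algebra.Lattice.Structures.Biased using (isBooleanAlgebraʳ)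
open import Algebra.Lattice.Bundles using (DistributiveLattice)
open import Algebra.Lattice.Morphism.Structures using (IsLatticeMonomorphism)
import Algebra.Lattice.Morphism.LatticeMonomorphism as LatticeMonomorphism
import Algebra.Lattice.Properties.DistributiveLattice as DistributiveLatticeProperties
import Algebra.Definitions

module BoundedDistributiveLattice
  {a : Level} {C : Set a} (_∨_ _∧_ : Op₂ C) (⊥ ⊤ : C)
  (isDistributiveLattice : IsDistributiveLattice _≡_ _∨_ _∧_)
  (∧-zeroʳ : ∀ x → x ∧ ⊥ ≡ ⊥) (∨-zeroʳ : ∀ x → x ∨ ⊤ ≡ ⊤)
  where
  open Algebra.Definitions (_≡_ {A = C})
  open IsDistributiveLattice isDistributiveLattice hiding (refl; sym; trans; reflexive)
  open ≡-Reasoning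

  ∨-identityʳ : RightIdentity ⊥ _∨_
  ∨-identityʳ x = trans (cong (x ∨_) (sym (∧-zeroʳ x))) (∨-absorbs-∧ x ⊥)

  ∧-identityʳ : RightIdentity ⊤ _∧_
  ∧-identityʳ x = trans (cong (x ∧_) (sym (∨-zeroʳ x))) (∧-absorbs-∨ x ⊤)

  ∧-disjoint : ∀ {x x' y y'} → x ∧ x' ≡ ⊥ → y ∧ y' ≡ ⊥ → (x ∧ y) ∧ (x' ∨ y') ≡ ⊥
  ∧-disjoint {x} {x'} {y} {y'} x∧x'≡⊥ y∧y'≡⊥ = begin
    (x ∧ y) ∧ (x' ∨ y')              ≡⟨ ∧-distribˡ-∨ (x ∧ y) x' y' ⟩
    ((x ∧ y) ∧ x') ∨ ((x ∧ y) ∧ y')  ≡⟨ cong₂ _∨_ x∧y∧x'≡⊥ x∧y∧y'≡⊥ ⟩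
    ⊥ ∨ ⊥                            ≡⟨ ∨-identityʳ ⊥ ⟩
    ⊥                                ∎
    where
    x∧y∧x'≡⊥ : (x ∧ y) ∧ x' ≡ ⊥
    x∧y∧x'≡⊥ = begin
      (x ∧ y) ∧ x'  ≡⟨ cong (_∧ x') (∧-comm x y) ⟩
      (y ∧ x) ∧ x'  ≡⟨ ∧-assoc y x x' ⟩
      y ∧ (x ∧ x')  ≡⟨ cong (y ∧_) x∧x'≡⊥ ⟩
      y ∧ ⊥         ≡⟨ ∧-zeroʳ y ⟩
      ⊥             ∎
    x∧y∧y'≡⊥ : (x ∧ y) ∧ y' ≡ ⊥
    x∧y∧y'≡⊥ = begin
      (x ∧ y) ∧ y'  ≡⟨ ∧-assoc x y y' ⟩
      x ∧ (y ∧ y')  ≡⟨ cong (x ∧_) y∧y'≡⊥ ⟩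
      x ∧ ⊥         ≡⟨ ∧-zeroʳ x ⟩
      ⊥             ∎

  ∧-covering : ∀ {x x' y y'} → x ∨ x' ≡ ⊤ → y ∨ y' ≡ ⊤ → (x ∧ y) ∨ (x' ∨ y') ≡ ⊤
  ∧-covering {x} {x'} {y} {y'} x∨x'≡⊤ y∨y'≡⊤ = begin
    (x ∧ y) ∨ (x' ∨ y')                ≡⟨ ∨-distribʳ-∧ (x' ∨ y') x y ⟩
    (x ∨ (x' ∨ y')) ∧ (y ∨ (x' ∨ y'))  ≡⟨ cong₂ _∧_ x∨x'∨y'≡⊤ y∨x'∨y'≡⊤ ⟩
    ⊤ ∧ ⊤                              ≡⟨ ∧-identityʳ ⊤ ⟩
    ⊤                                  ∎
    where
    x∨x'∨y'≡⊤ : x ∨ (x' ∨ y') ≡ ⊤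
    x∨x'∨y'≡⊤ = begin
      x ∨ (x' ∨ y')  ≡⟨ ∨-assoc x x' y' ⟨
      (x ∨ x') ∨ y'  ≡⟨ cong (_∨ y') x∨x'≡⊤ ⟩
      ⊤ ∨ y'         ≡⟨ ∨-comm ⊤ y' ⟩
      y' ∨ ⊤         ≡⟨ ∨-zeroʳ y' ⟩
      ⊤              ∎
    y∨x'∨y'≡⊤ : y ∨ (x' ∨ y') ≡ ⊤
    y∨x'∨y'≡⊤ = begin
      y ∨ (x' ∨ y')  ≡⟨ cong (y ∨_) (∨-comm x' y') ⟩
      y ∨ (y' ∨ x')  ≡⟨ ∨-assoc y y' x' ⟨
      (y ∨ y') ∨ x'  ≡⟨ cong (_∨ x') y∨y'≡⊤ ⟩
      ⊤ ∨ x'         ≡⟨ ∨-comm ⊤ x' ⟩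
      x' ∨ ⊤         ≡⟨ ∨-zeroʳ x' ⟩
      ⊤              ∎

  disjoint-covering⇒≤ : ∀ {x y w} → x ∧ y ≡ ⊥ → x ∨ w ≡ ⊤ → y ≡ y ∧ w
  disjoint-covering⇒≤ {x} {y} {w} x∧y≡⊥ x∨w≡⊤ = begin
    y                  ≡⟨ ∧-identityʳ y ⟨
    y ∧ ⊤              ≡⟨ cong (y ∧_) x∨w≡⊤ ⟨
    y ∧ (x ∨ w)        ≡⟨ ∧-distribˡ-∨ y x w ⟩
    (y ∧ x) ∨ (y ∧ w)  ≡⟨ cong (_∨ (y ∧ w)) (trans (∧-comm y x) x∧y≡⊥) ⟩
    ⊥ ∨ (y ∧ w)        ≡⟨ ∨-comm ⊥ (y ∧ w) ⟩
    (y ∧ w) ∨ ⊥        ≡⟨ ∨-identityʳ (y ∧ w) ⟩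
    y ∧ w              ∎

  complement-unique : ∀ {x y w} → x ∧ y ≡ ⊥ → x ∨ y ≡ ⊤ →
                      x ∧ w ≡ ⊥ → x ∨ w ≡ ⊤ → y ≡ w
  complement-unique {x} {y} {w} x∧y≡⊥ x∨y≡⊤ x∧w≡⊥ x∨w≡⊤ = begin
    y      ≡⟨ disjoint-covering⇒≤ x∧y≡⊥ x∨w≡⊤ ⟩
    y ∧ w  ≡⟨ ∧-comm y w ⟩
    w ∧ y  ≡⟨ disjoint-covering⇒≤ x∧w≡⊥ x∨y≡⊤ ⟨
    w      ∎

  module _ (□ ◇ : Op₁ C) where

    □◇-disjoint : ◇ ⊥ ≡ ⊥ → (∀ x y → (□ x ∧ ◇ y) ∧ ◇ (x ∧ y) ≡ □ x ∧ ◇ y) →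
                  ∀ {x x'} → x ∧ x' ≡ ⊥ → □ x ∧ ◇ x' ≡ ⊥
    □◇-disjoint ◇⊥≡⊥ □∧◇≤◇∧ {x} {x'} x∧x'≡⊥ = begin
      □ x ∧ ◇ x'                   ≡⟨ □∧◇≤◇∧ x x' ⟨
      (□ x ∧ ◇ x') ∧ ◇ (x ∧ x')    ≡⟨ cong (λ u → (□ x ∧ ◇ x') ∧ ◇ u) x∧x'≡⊥ ⟩
      (□ x ∧ ◇ x') ∧ ◇ ⊥           ≡⟨ cong ((□ x ∧ ◇ x') ∧_) ◇⊥≡⊥ ⟩
      (□ x ∧ ◇ x') ∧ ⊥             ≡⟨ ∧-zeroʳ (□ x ∧ ◇ x') ⟩
      ⊥                            ∎

    □◇-covering : □ ⊤ ≡ ⊤ → (∀ x y → □ (x ∨ y) ∧ (□ x ∨ ◇ y) ≡ □ (x ∨ y)) →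
                  ∀ {x x'} → x ∨ x' ≡ ⊤ → □ x ∨ ◇ x' ≡ ⊤
    □◇-covering □⊤≡⊤ □∨≤□∨◇ {x} {x'} x∨x'≡⊤ = begin
      □ x ∨ ◇ x'                   ≡⟨ ∧-identityʳ (□ x ∨ ◇ x') ⟨
      (□ x ∨ ◇ x') ∧ ⊤             ≡⟨ ∧-comm (□ x ∨ ◇ x') ⊤ ⟩
      ⊤ ∧ (□ x ∨ ◇ x')             ≡⟨ cong (_∧ (□ x ∨ ◇ x')) □x∨x'≡⊤ ⟨
      □ (x ∨ x') ∧ (□ x ∨ ◇ x')    ≡⟨ □∨≤□∨◇ x x' ⟩
      □ (x ∨ x')                   ≡⟨ □x∨x'≡⊤ ⟩
      ⊤                            ∎
      where
      □x∨x'≡⊤ : □ (x ∨ x') ≡ ⊤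
      □x∨x'≡⊤ = trans (cong □ x∨x'≡⊤) □⊤≡⊤

module _ {a : Level} (A : TDL a) where
  open TDL A
  open IsDistributiveLattice isDistributiveLattice hiding (refl; sym; trans; reflexive)

  ∧-zeroʳ : ∀ x → x ∧ 𝟘 ≡ 𝟘
  ∧-zeroʳ x = trans (∧-comm x 𝟘) (𝟘-bot x)

  ∨-zeroʳ : ∀ x → x ∨ 𝟙 ≡ 𝟙
  ∨-zeroʳ x = begin
    x ∨ 𝟙        ≡⟨ ∨-comm x 𝟙 ⟩
    𝟙 ∨ x        ≡⟨ cong (𝟙 ∨_) (trans (∧-comm 𝟙 x) (𝟙-top x)) ⟨
    𝟙 ∨ (𝟙 ∧ x)  ≡⟨ ∨-absorbs-∧ 𝟙 x ⟩
    𝟙            ∎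
    where open ≡-Reasoning

  open BoundedDistributiveLattice _∨_ _∧_ 𝟘 𝟙 isDistributiveLattice ∧-zeroʳ ∨-zeroʳ

  distributiveLattice : DistributiveLattice a a
  distributiveLattice = record { isDistributiveLattice = isDistributiveLattice }

  module Dual = BoundedDistributiveLattice _∧_ _∨_ 𝟙 𝟘
    (DistributiveLatticeProperties.∧-∨-isDistributiveLattice distributiveLattice)
    ∨-zeroʳ ∧-zeroʳ

  -- In the order dual, disjointness and covering trade places; this gives De Morgan for ∨.
  complemented-closure : BClosure A
  complemented-closure = record
    { ∧-closed = λ { (x' , x∧x'≡𝟘 , x∨x'≡𝟙) (y' , y∧y'≡𝟘 , y∨y'≡𝟙) →
        x' ∨ y' , ∧-disjoint x∧x'≡𝟘 y∧y'≡𝟘 , ∧-covering x∨x'≡𝟙 y∨y'≡𝟙 }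
    ; ∨-closed = λ { (x' , x∧x'≡𝟘 , x∨x'≡𝟙) (y' , y∧y'≡𝟘 , y∨y'≡𝟙) →
        x' ∧ y' , Dual.∧-covering x∧x'≡𝟘 y∧y'≡𝟘 , Dual.∧-disjoint x∨x'≡𝟙 y∨y'≡𝟙 }
    ; 𝟘-closed = 𝟙 , 𝟘-bot 𝟙 , trans (∨-comm 𝟘 𝟙) (∨-identityʳ 𝟙)
    ; 𝟙-closed = 𝟘 , ∧-zeroʳ 𝟙 , ∨-identityʳ 𝟙
    ; G-closed = λ { (x' , x∧x'≡𝟘 , x∨x'≡𝟙) →
        F x' , □◇-disjoint G F t5F t8F x∧x'≡𝟘 , □◇-covering G F t1G t4G x∨x'≡𝟙 }
    ; H-closed = λ { (x' , x∧x'≡𝟘 , x∨x'≡𝟙) →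
        P x' , □◇-disjoint H P t5P t8P x∧x'≡𝟘 , □◇-covering H P t1H t4H x∨x'≡𝟙 }
    }

  open BOps A complemented-closure

  proj₁-isLatticeMonomorphism :
    IsLatticeMonomorphism
      (record { Carrier = BA A ; _≈_ = _≈B_ A ; _∨_ = _∨B_ ; _∧_ = _∧B_ })
      (record { Carrier = Carrier ; _≈_ = _≡_ ; _∨_ = _∨_ ; _∧_ = _∧_ })
      proj₁
  proj₁-isLatticeMonomorphism = record
    { isLatticeHomomorphism = record
      { isRelHomomorphism = record { cong = id }
      ; ∧-homo = λ _ _ → refl
      ; ∨-homo = λ _ _ → refl
      }
    ; injective = id
    }

  complemented-isTense : BIsTense A complemented-closure
  complemented-isTense = record
    { isBooleanAlgebra = isBooleanAlgebraʳ (record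
      { isDistributiveLattice =
          LatticeMonomorphism.isDistributiveLattice proj₁-isLatticeMonomorphism
            isDistributiveLattice
      ; ∨-complementʳ = λ { (_ , _ , _ , x∨x'≡𝟙) → x∨x'≡𝟙 }
      ; ∧-complementʳ = λ { (_ , _ , x∧x'≡𝟘 , _) → x∧x'≡𝟘 }
      ; ¬-cong = λ { {_ , _ , x∧y≡𝟘 , x∨y≡𝟙} {_ , _ , x∧w≡𝟘 , x∨w≡𝟙} refl →
          complement-unique x∧y≡𝟘 x∨y≡𝟙 x∧w≡𝟘 x∨w≡𝟙 }
      })
    ; G-cong = cong G
    ; H-cong = cong H
    ; t1G = t1G
    ; t1H = t1H
    ; t2G = λ x y → t2G (proj₁ x) (proj₁ y)
    ; t2H = λ x y → t2H (proj₁ x) (proj₁ y)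
    ; t3G = λ x → t3G (proj₁ x)
    ; t3H = λ x → t3H (proj₁ x)
    }

lemma2p14 : {a : Level} (A : TDL a) → Σ (BClosure A) (BIsTense A)
lemma2p14 A = complemented-closure A , complemented-isTense A
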